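{- If $M_G$ is a connected mixed graph whose rank is $2$, then its underlying graph $G$ is a complete bipartite graph.
   Context: A mixed graph $M_G$ is obtained from a finite simple graph $G$ (its underlying graph) by orienting the edges of some subset of $E(G)$. With $\omega=\frac{1+\mathbf{i}\sqrt3}{2}$, $N(M_G)$ has $(u,v)$-entry $\omega$ if $\overrightarrow{uv}$ is an arc, $\bar\omega$ if $\overrightarrow{vu}$ is an arc, $1$ for an undirected edge $\{u,v\}$, $0$ otherwise. The rank of $M_G$ is the rank of $N(M_G)$. $M_G$ is connected if $G$ is. -}

module Defs where

open import Data.Nat using (ℕ; zero; suc)
open import Data.Integer as ℤ using (ℤ; 0ℤ; 1ℤ; -1ℤ)
open import Data.Fin using (Fin; zero; suc; punchIn)
open import Data.Bool using (Bool; true; false)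
open import Data.Product using (Σ; ∃; _×_; _,_)
open import Relation.Binary.PropositionalEquality using (_≡_; _≢_)
open import Relation.Nullary using (¬_)

-- Eisenstein integers ℤ[ω], ω = (1 + i√3)/2, so ω² = ω - 1 and ω̄ = 1 - ω.
-- An element a + bω is represented by the pair (a , b); since {1, ω} is a
-- ℤ-basis, propositional equality of records is equality of complex numbers.

record Eis : Set where
  constructor _+_ω
  field
    re : ℤ
    om : ℤ

open Eis public

0E 1E ωE ω̄E : Eis
0E  = 0ℤ + 0ℤ ω
1E  = 1ℤ + 0ℤ ω
ωE  = 0ℤ + 1ℤ ω
ω̄E  = 1ℤ + -1ℤ ω

infixl 6 _+E_
infixl 7 _*E_

_+E_ : Eis → Eis → Eis
(a + b ω) +E (c + d ω) = (a ℤ.+ c) + (b ℤ.+ d) ω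

-E_ : Eis → Eis
-E (a + b ω) = (ℤ.- a) + (ℤ.- b) ω

-- (a + bω)(c + dω) = (ac - bd) + (ad + bc + bd)ω   using ω² = ω - 1
_*E_ : Eis → Eis → Eis
(a + b ω) *E (c + d ω) =
  (a ℤ.* c ℤ.- b ℤ.* d) + (a ℤ.* d ℤ.+ b ℤ.* c ℤ.+ b ℤ.* d) ω

sumFin : ∀ {k} → (Fin k → Eis) → Eis
sumFin {zero}  f = 0E
sumFin {suc k} f = f zero +E sumFin (λ j → f (suc j))

sign : ∀ {k} → Fin k → Eis
sign zero    = 1E
sign (suc j) = -E (sign j)

det : ∀ k → (Fin k → Fin k → Eis) → Eis
det zero    A = 1E
det (suc k) A =
  sumFin (λ j → sign j *E (A zero j *E det k (λ i l → A (suc i) (punchIn j l))))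

minor : ∀ {n} k → (Fin n → Fin n → Eis) → (Fin k → Fin n) → (Fin k → Fin n) → Eis
minor k M r c = det k (λ i j → M (r i) (c j))

HasRank : ∀ {n} → (Fin n → Fin n → Eis) → ℕ → Set
HasRank {n} M k =
  (Σ (Fin k → Fin n) λ r → Σ (Fin k → Fin n) λ c → minor k M r c ≢ 0E)
  × (∀ (r c : Fin (suc k) → Fin n) → minor (suc k) M r c ≡ 0E)

-- entry for an ordered pair (u , v)
data Link : Set where
  none       : Link
  undirected : Link
  arcOut     : Link   -- arc u → v
  arcIn      : Link   -- arc v → u

flipL : Link → Link
flipL none       = none
flipL undirected = undirected
flipL arcOut     = arcIn
flipL arcIn      = arcOut

record MixedGraph (n : ℕ) : Set where
  field
    link     : Fin n → Fin n → Link
    loopless : ∀ u → link u u ≡ none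
    symm     : ∀ u v → link v u ≡ flipL (link u v)

open MixedGraph public

Adj : ∀ {n} → MixedGraph n → Fin n → Fin n → Set
Adj M u v = link M u v ≢ none

entry : Link → Eis
entry none       = 0E
entry undirected = 1E
entry arcOut     = ωE
entry arcIn      = ω̄E

N : ∀ {n} → MixedGraph n → Fin n → Fin n → Eis
N M u v = entry (link M u v)

rank : ∀ {n} → MixedGraph n → ℕ → Set
rank M k = HasRank (N M) k

data Reach {n} (M : MixedGraph n) : Fin n → Fin n → Set where
  here : ∀ {u} → Reach M u u
  step : ∀ {u v w} → Adj M u v → Reach M v w → Reach M u w

Connected : ∀ {n} → MixedGraph n → Set
Connected {n} M = ∀ (u v : Fin n) → Reach M u v

CompleteBipartite : ∀ {n} → MixedGraph n → Set
CompleteBipartite {n} M =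
  Σ (Fin n → Bool) λ p →
    (∃ λ u → p u ≡ true) × (∃ λ v → p v ≡ false)
    × (∀ u v → (Adj M u v → p u ≢ p v) × (p u ≢ p v → Adj M u v))

-- A nonzero 2×2 minor contains a nonzero entry, i.e. an edge uv.  The 3×3 minor of N
-- on rows u, v, w and columns u, v, x depends only on the six links among u, v, w, x,
-- and checking all 4⁶ link patterns over ℤ[ω] shows that its vanishing forces: no
-- vertex is adjacent to both u and v; a vertex adjacent to neither is isolated, which
-- connectivity rules out; two vertices on the same side of uv are non-adjacent; and two
-- on opposite sides are adjacent.  So "adjacent to v" is a complete bipartition.

module Submission where

open import Defs
open import Data.Nat using (ℕ; zero; suc)
import Data.Integer as ℤ
import Data.Integer.Properties as ℤ
open import Data.Fin using (Fin; zero; suc; punchIn)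
open import Data.Fin.Properties using (¬∀⟶∃¬)
open import Data.Vec.Functional using (_∷_; [])
open import Data.Product using (∃; _×_; _,_)
open import Data.Empty using (⊥-elim)
open import Function using (_∘_)
open import Relation.Binary.Definitions using (DecidableEquality)
open import Relation.Binary.PropositionalEquality
  using (_≡_; _≢_; refl; sym; trans; cong; cong₂; subst)
open import Relation.Nullary using (Dec; yes; no; does; ¬_; ¬?)
open import Relation.Nullary.Decidable
  using (map′; _×-dec_; _→-dec_; from-yes; decidable-stable; dec-true; dec-false)

none? : (ℓ : Link) → Dec (ℓ ≡ none)
none? none       = yes refl
none? undirected = no λ ()
none? arcOut     = no λ ()
none? arcIn      = no λ ()

∀-Link? : {P : Link → Set} → (∀ ℓ → Dec (P ℓ)) → Dec (∀ ℓ → P ℓ)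
∀-Link? {P} P? =
  map′ at-all at-each (P? none ×-dec P? undirected ×-dec P? arcOut ×-dec P? arcIn)
  where
  at-all : P none × P undirected × P arcOut × P arcIn → ∀ ℓ → P ℓ
  at-all (p , _ , _ , _) none       = p
  at-all (_ , p , _ , _) undirected = p
  at-all (_ , _ , p , _) arcOut     = p
  at-all (_ , _ , _ , p) arcIn      = p

  at-each : (∀ ℓ → P ℓ) → P none × P undirected × P arcOut × P arcIn
  at-each p = p none , p undirected , p arcOut , p arcIn

flipL-none : ∀ ℓ → flipL ℓ ≡ none → ℓ ≡ none
flipL-none none _ = refl

_≟E_ : DecidableEquality Eis
(a + b ω) ≟E (c + d ω) =
  map′ (λ (p , q) → cong₂ _+_ω p q) (λ p → cong re p , cong om p) (a ℤ.≟ c ×-dec b ℤ.≟ d)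

*E-zeroʳ : ∀ x → x *E 0E ≡ 0E
*E-zeroʳ (a + b ω) rewrite ℤ.*-zeroʳ a | ℤ.*-zeroʳ b = refl

sumFin-zero : ∀ {k} (f : Fin k → Eis) → (∀ j → f j ≡ 0E) → sumFin f ≡ 0E
sumFin-zero {zero}  f f≡0 = refl
sumFin-zero {suc k} f f≡0 rewrite f≡0 zero | sumFin-zero (f ∘ suc) (f≡0 ∘ suc) = refl

sumFin-cong : ∀ {k} {f g : Fin k → Eis} → (∀ j → f j ≡ g j) → sumFin f ≡ sumFin g
sumFin-cong {zero}  f≡g = refl
sumFin-cong {suc k} f≡g = cong₂ _+E_ (f≡g zero) (sumFin-cong (f≡g ∘ suc))

det-cong : ∀ k {A B : Fin k → Fin k → Eis} → (∀ i j → A i j ≡ B i j) → det k A ≡ det k B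
det-cong zero    A≡B = refl
det-cong (suc k) A≡B = sumFin-cong λ j →
  cong₂ (λ x D → sign j *E (x *E D))
        (A≡B zero j) (det-cong k λ i l → A≡B (suc i) (punchIn j l))

det-zero-row : ∀ k (A : Fin (suc k) → Fin (suc k) → Eis) →
  (∀ j → A zero j ≡ 0E) → det (suc k) A ≡ 0E
det-zero-row k A row≡0 =
  sumFin-zero _ λ j → term≡0 j (det k λ i l → A (suc i) (punchIn j l))
  where
  term≡0 : ∀ j D → sign j *E (A zero j *E D) ≡ 0E
  term≡0 j D rewrite row≡0 j = *E-zeroʳ (sign j)

det≢0⇒first-row-entry≢0 : ∀ k (A : Fin (suc k) → Fin (suc k) → Eis) →
  det (suc k) A ≢ 0E → ∃ λ j → A zero j ≢ 0E
det≢0⇒first-row-entry≢0 k A det≢0 =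
  ¬∀⟶∃¬ (suc k) _ (λ j → A zero j ≟E 0E) (det≢0 ∘ det-zero-row k A)

-- The submatrix of N on rows u, v, w and columns u, v, x, where
-- ℓ = link u v, a = link w u, b = link w v, c = link x u, d = link x v, e = link w x.
edgeLinks : (ℓ a b c d e : Link) → Fin 3 → Fin 3 → Link
edgeLinks ℓ a b c d e = (none    ∷ ℓ    ∷ flipL c ∷ [])
                      ∷ (flipL ℓ ∷ none ∷ flipL d ∷ [])
                      ∷ (a       ∷ b    ∷ e       ∷ [])
                      ∷ []

edgeMinor : (ℓ a b c d e : Link) → Eis
edgeMinor ℓ a b c d e = det 3 λ i j → entry (edgeLinks ℓ a b c d e i j)

edgeMinor-common-neighbour : ∀ ℓ a b e → ℓ ≢ none → a ≢ none → b ≢ none → e ≡ none →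
  edgeMinor ℓ a b a b e ≢ 0E
edgeMinor-common-neighbour = from-yes
  (∀-Link? λ ℓ → ∀-Link? λ a → ∀-Link? λ b → ∀-Link? λ e →
    ¬? (none? ℓ) →-dec ¬? (none? a) →-dec ¬? (none? b) →-dec none? e →-dec
    ¬? (edgeMinor ℓ a b a b e ≟E 0E))

edgeMinor-isolated : ∀ ℓ a b c d e → ℓ ≢ none → a ≡ none → b ≡ none → e ≢ none →
  edgeMinor ℓ a b c d e ≢ 0E
edgeMinor-isolated = from-yes
  (∀-Link? λ ℓ → ∀-Link? λ a → ∀-Link? λ b → ∀-Link? λ c → ∀-Link? λ d → ∀-Link? λ e →
    ¬? (none? ℓ) →-dec none? a →-dec none? b →-dec ¬? (none? e) →-dec
    ¬? (edgeMinor ℓ a b c d e ≟E 0E))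

edgeMinor-same-side : ∀ ℓ a b c d e → ℓ ≢ none →
  a ≢ none → b ≡ none → c ≢ none → d ≡ none → e ≢ none →
  edgeMinor ℓ a b c d e ≢ 0E
edgeMinor-same-side = from-yes
  (∀-Link? λ ℓ → ∀-Link? λ a → ∀-Link? λ b → ∀-Link? λ c → ∀-Link? λ d → ∀-Link? λ e →
    ¬? (none? ℓ) →-dec ¬? (none? a) →-dec none? b →-dec ¬? (none? c) →-dec none? d →-dec
    ¬? (none? e) →-dec ¬? (edgeMinor ℓ a b c d e ≟E 0E))

edgeMinor-opposite-sides : ∀ ℓ a b c d e → ℓ ≢ none →
  a ≢ none → b ≡ none → c ≡ none → d ≢ none → e ≡ none →
  edgeMinor ℓ a b c d e ≢ 0E
edgeMinor-opposite-sides = from-yes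
  (∀-Link? λ ℓ → ∀-Link? λ a → ∀-Link? λ b → ∀-Link? λ c → ∀-Link? λ d → ∀-Link? λ e →
    ¬? (none? ℓ) →-dec ¬? (none? a) →-dec none? b →-dec none? c →-dec ¬? (none? d) →-dec
    none? e →-dec ¬? (edgeMinor ℓ a b c d e ≟E 0E))

module _ {n : ℕ} (M : MixedGraph n) where

  adj? : ∀ u v → Dec (Adj M u v)
  adj? u v = ¬? (none? (link M u v))

  ¬Adj⇒none : ∀ {u v} → ¬ Adj M u v → link M u v ≡ none
  ¬Adj⇒none = decidable-stable (none? _)

  Adj-sym : ∀ {u v} → Adj M u v → Adj M v u
  Adj-sym {u} {v} uv vu≡none = uv (flipL-none _ (subst (_≡ none) (symm M u v) vu≡none))

  N≢0⇒Adj : ∀ {u v} → N M u v ≢ 0E → Adj M u v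
  N≢0⇒Adj N≢0 = N≢0 ∘ cong entry

  connected⇒neighbour : Connected M → ∀ {u v} → Adj M u v → ∀ w → ∃ (Adj M w)
  connected⇒neighbour conn {u} {v} uv w with conn w u
  ... | here           = v , uv
  ... | step {v = x} wx _ = x , wx

module ThreeMinorsVanish {n : ℕ} (M : MixedGraph n)
  (vanish : ∀ (r c : Fin 3 → Fin n) → minor 3 (N M) r c ≡ 0E) where

  private
    L : Fin n → Fin n → Link
    L = link M

  minor-at-edge : ∀ u v w x →
    minor 3 (N M) (u ∷ v ∷ w ∷ []) (u ∷ v ∷ x ∷ []) ≡
    edgeMinor (L u v) (L w u) (L w v) (L x u) (L x v) (L w x)
  minor-at-edge u v w x = det-cong 3 entries
    where
    entries : ∀ i j → N M ((u ∷ v ∷ w ∷ []) i) ((u ∷ v ∷ x ∷ []) j) ≡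
                      entry (edgeLinks (L u v) (L w u) (L w v) (L x u) (L x v) (L w x) i j)
    entries zero             zero             = cong entry (loopless M u)
    entries zero             (suc zero)       = refl
    entries zero             (suc (suc zero)) = cong entry (symm M x u)
    entries (suc zero)       zero             = cong entry (symm M u v)
    entries (suc zero)       (suc zero)       = cong entry (loopless M v)
    entries (suc zero)       (suc (suc zero)) = cong entry (symm M x v)
    entries (suc (suc zero)) zero             = refl
    entries (suc (suc zero)) (suc zero)       = refl
    entries (suc (suc zero)) (suc (suc zero)) = refl

  edgeMinor-vanishes : ∀ u v w x →
    edgeMinor (L u v) (L w u) (L w v) (L x u) (L x v) (L w x) ≡ 0E
  edgeMinor-vanishes u v w x =
    trans (sym (minor-at-edge u v w x)) (vanish (u ∷ v ∷ w ∷ []) (u ∷ v ∷ x ∷ []))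

  no-common-neighbour : ∀ {u v w} → Adj M u v → Adj M w u → ¬ Adj M w v
  no-common-neighbour {u} {v} {w} uv wu wv =
    edgeMinor-common-neighbour (L u v) (L w u) (L w v) (L w w)
      uv wu wv (loopless M w) (edgeMinor-vanishes u v w w)

  non-neighbour-isolated : ∀ {u v w x} → Adj M u v → ¬ Adj M w u → ¬ Adj M w v → ¬ Adj M w x
  non-neighbour-isolated {u} {v} {w} {x} uv ¬wu ¬wv wx =
    edgeMinor-isolated (L u v) (L w u) (L w v) (L x u) (L x v) (L w x)
      uv (¬Adj⇒none M ¬wu) (¬Adj⇒none M ¬wv) wx
      (edgeMinor-vanishes u v w x)

  OnSide : Fin n → Fin n → Fin n → Set
  OnSide u v w = Adj M w u × ¬ Adj M w v

  same-side⇒¬Adj : ∀ {u v w x} → Adj M u v → OnSide u v w → OnSide u v x → ¬ Adj M w x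
  same-side⇒¬Adj {u} {v} {w} {x} uv (wu , ¬wv) (xu , ¬xv) wx =
    edgeMinor-same-side (L u v) (L w u) (L w v) (L x u) (L x v) (L w x)
      uv wu (¬Adj⇒none M ¬wv) xu (¬Adj⇒none M ¬xv) wx
      (edgeMinor-vanishes u v w x)

  opposite-sides⇒Adj : ∀ {u v w x} → Adj M u v → OnSide u v w → OnSide v u x → Adj M w x
  opposite-sides⇒Adj {u} {v} {w} {x} uv (wu , ¬wv) (xv , ¬xu) wx≡none =
    edgeMinor-opposite-sides (L u v) (L w u) (L w v) (L x u) (L x v) (L w x)
      uv wu (¬Adj⇒none M ¬wv) (¬Adj⇒none M ¬xu) xv wx≡none
      (edgeMinor-vanishes u v w x)

  module _ (conn : Connected M) {u v} (uv : Adj M u v) where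

    on-u-side : ∀ {w} → ¬ Adj M w v → OnSide u v w
    on-u-side {w} ¬wv = decidable-stable (adj? M w u) ¬¬wu , ¬wv
      where
      ¬¬wu : ¬ ¬ Adj M w u
      ¬¬wu ¬wu = let x , wx = connected⇒neighbour M conn uv w
                 in non-neighbour-isolated uv ¬wu ¬wv wx

    on-v-side : ∀ {w} → Adj M w v → OnSide v u w
    on-v-side wv = wv , no-common-neighbour (Adj-sym M uv) wv

    Adj⇔different-sides : ∀ {w x} (wv? : Dec (Adj M w v)) (xv? : Dec (Adj M x v)) →
      (Adj M w x → does wv? ≢ does xv?) × (does wv? ≢ does xv? → Adj M w x)
    Adj⇔different-sides (yes wv) (yes xv) =
      (λ wx _ → same-side⇒¬Adj (Adj-sym M uv) (on-v-side wv) (on-v-side xv) wx)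
      , λ ne → ⊥-elim (ne refl)
    Adj⇔different-sides (yes wv) (no ¬xv) =
      (λ _ ()) , λ _ → opposite-sides⇒Adj (Adj-sym M uv) (on-v-side wv) (on-u-side ¬xv)
    Adj⇔different-sides (no ¬wv) (yes xv) =
      (λ _ ()) , λ _ → opposite-sides⇒Adj uv (on-u-side ¬wv) (on-v-side xv)
    Adj⇔different-sides (no ¬wv) (no ¬xv) =
      (λ wx _ → same-side⇒¬Adj uv (on-u-side ¬wv) (on-u-side ¬xv) wx)
      , λ ne → ⊥-elim (ne refl)

    completeBipartite : CompleteBipartite M
    completeBipartite =
      (λ w → does (adj? M w v))
      , (u , dec-true (adj? M u v) uv)
      , (v , dec-false (adj? M v v) (λ vv → vv (loopless M v)))
      , λ w x → Adj⇔different-sides (adj? M w v) (adj? M x v)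

theorem5p7 : ∀ {n : ℕ} (M : MixedGraph n) →
    Connected M → rank M 2 → CompleteBipartite M
theorem5p7 M conn ((r , c , minor≢0) , vanish) =
  let _ , entry≢0 = det≢0⇒first-row-entry≢0 1 (λ i j → N M (r i) (c j)) minor≢0
  in ThreeMinorsVanish.completeBipartite M vanish conn (N≢0⇒Adj M entry≢0)
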